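{- Suppose that $\Gamma\vdash A$ is derivable in $\mathcal{S}$, where the sequence $\Gamma$ is proper and the formula $A$ is constant. Then $\Gamma$ is constant.
   Context: System $\mathcal{S}$: formulae are built from an infinite set of propositional letters and a constant $I$ using binary connectives $\otimes$ and $\to$. Sequents are $\Gamma\vdash A$ with $\Gamma$ a finite, possibly empty, sequence of formulae and $A$ a formula. Axioms: $A\vdash A$ and $\vdash I$. Rules: weakening: from $\Gamma\vdash A$ infer $I,\Gamma\vdash A$; interchange: from $\Gamma,A,B,\Delta\vdash C$ infer $\Gamma,B,A,\Delta\vdash C$; cut: from $\Gamma\vdash A$ and $\Delta,A,\Theta\vdash B$ infer $\Delta,\Gamma,\Theta\vdash B$; $(\otimes\vdash)$: from $\Gamma,A,B,\Delta\vdash C$ infer $\Gamma,A\otimes B,\Delta\vdash C$; $(\vdash\otimes)$: from $\Gamma\vdash A$ and $\Delta\vdash B$ infer $\Gamma,\Delta\vdash A\otimes B$; $(\to\vdash)$: from $\Gamma\vdash A$ and $B,\Delta\vdash C$ infer $\Gamma,A\to B,\Delta\vdash C$; $(\vdash\to)$: from $A,\Gamma\vdash B$ infer $\Gamma\vdash A\to B$. A formula is constant if it contains no propositional letters; a sequence is constant if it is empty or consists only of constant formulae. A formula is proper if it contains no subformula $B\to C$ with $C$ constant and $B$ not constant; a sequence is proper if all its formulae are proper. -}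

module Defs where

open import Data.Nat using (ℕ)
open import Data.List using (List; []; _∷_; _++_)
open import Data.List.Relation.Unary.All using (All)
open import Data.Product using (_×_)
open import Relation.Nullary using (¬_)

infixr 6 _⊗_
infixr 5 _⇒_
data Formula : Set where
  var : ℕ → Formula
  I   : Formula
  _⊗_ : Formula → Formula → Formula
  _⇒_ : Formula → Formula → Formula

infix 3 _⊢_
data _⊢_ : List Formula → Formula → Set where
  ax      : ∀ {A} → (A ∷ []) ⊢ A
  axI     : [] ⊢ I
  weak    : ∀ {Γ A} → Γ ⊢ A → (I ∷ Γ) ⊢ A
  interch : ∀ {Γ Δ A B C} → (Γ ++ A ∷ B ∷ Δ) ⊢ C → (Γ ++ B ∷ A ∷ Δ) ⊢ C
  cut     : ∀ {Γ Δ Θ A B} → Γ ⊢ A → (Δ ++ A ∷ Θ) ⊢ B → (Δ ++ Γ ++ Θ) ⊢ B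
  ⊗L      : ∀ {Γ Δ A B C} → (Γ ++ A ∷ B ∷ Δ) ⊢ C → (Γ ++ (A ⊗ B) ∷ Δ) ⊢ C
  ⊗R      : ∀ {Γ Δ A B} → Γ ⊢ A → Δ ⊢ B → (Γ ++ Δ) ⊢ (A ⊗ B)
  ⇒L      : ∀ {Γ Δ A B C} → Γ ⊢ A → (B ∷ Δ) ⊢ C → (Γ ++ (A ⇒ B) ∷ Δ) ⊢ C
  ⇒R      : ∀ {Γ A B} → (A ∷ Γ) ⊢ B → Γ ⊢ (A ⇒ B)

data Constant : Formula → Set where
  cI : Constant I
  c⊗ : ∀ {A B} → Constant A → Constant B → Constant (A ⊗ B)
  c⇒ : ∀ {A B} → Constant A → Constant B → Constant (A ⇒ B)

ConstantSeq : List Formula → Set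
ConstantSeq Γ = All Constant Γ

data _≼_ : Formula → Formula → Set where
  here : ∀ {A} → A ≼ A
  ⊗l   : ∀ {B A C} → B ≼ A → B ≼ (A ⊗ C)
  ⊗r   : ∀ {B A C} → B ≼ C → B ≼ (A ⊗ C)
  ⇒l   : ∀ {B A C} → B ≼ A → B ≼ (A ⇒ C)
  ⇒r   : ∀ {B A C} → B ≼ C → B ≼ (A ⇒ C)

Proper : Formula → Set
Proper A = ∀ B C → (B ⇒ C) ≼ A → ¬ (Constant C × ¬ Constant B)

ProperSeq : List Formula → Set
ProperSeq Γ = All Proper Γ

-- Sequents are sound in every commutative residuated preordered monoid when I
-- is read as the unit, ⊗ as the product, → as the residual and a sequence as
-- the product of its members. Take the three-element Sugihara monoid
-- -1 < 0 < 1 and send every letter to 1; constant formulae then denote the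
-- unit 0. On {0, 1} the product and the residual return 1 as soon as an
-- argument is 1, except for 1 → 0 = -1, which properness excludes; so a proper
-- formula or sequence that is not constant denotes 1, and 1 ≰ 0.
module Submission where

open import Level using (0ℓ; _⊔_; suc)
open import Data.Nat using (ℕ)
open import Data.List using (List; []; _∷_; _++_)
open import Data.List.Relation.Unary.All using ([]; _∷_)
open import Data.Product using (_,_)
open import Data.Sum using (_⊎_; inj₁; inj₂)
open import Data.Empty using (⊥-elim)
open import Relation.Nullary using (¬_)
open import Relation.Binary.Core using (Rel; _Preserves₂_⟶_⟶_)
open import Relation.Binary.Structures using (IsPreorder)
open import Relation.Binary.Bundles using (Preorder)
open import Relation.Binary.PropositionalEquality as ≡
  using (_≡_; refl; cong₂; subst₂; isEquivalence)
open import Relation.Binary.PropositionalEquality.Algebra using (isMagma)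
open import Algebra.Core using (Op₂)
open import Algebra.Structures using (IsCommutativeMonoid)
open import Algebra.Structures.Biased using (isCommutativeMonoidˡ)
open import Algebra.Bundles using (CommutativeSemigroup)
import Algebra.Properties.CommutativeSemigroup as CommutativeSemigroupProperties
import Relation.Binary.Reasoning.Preorder as PreorderReasoning

open import Defs

record ResiduatedCommutativeMonoid c ℓ₁ ℓ₂ : Set (suc (c ⊔ ℓ₁ ⊔ ℓ₂)) where
  infix  4 _≈_ _≤_
  infixr 6 _∙_
  infixr 5 _⇨_
  field
    Carrier             : Set c
    _≈_                 : Rel Carrier ℓ₁
    _≤_                 : Rel Carrier ℓ₂
    _∙_                 : Op₂ Carrier
    ε                   : Carrier
    _⇨_                 : Op₂ Carrier
    isCommutativeMonoid : IsCommutativeMonoid _≈_ _∙_ ε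
    isPreorder          : IsPreorder _≈_ _≤_
    ∙-mono              : _∙_ Preserves₂ _≤_ ⟶ _≤_ ⟶ _≤_
    ⇨-curry             : ∀ {x y z} → x ∙ y ≤ z → y ≤ x ⇨ z
    ⇨-eval              : ∀ x y → x ∙ (x ⇨ y) ≤ y

  open IsCommutativeMonoid isCommutativeMonoid public
  open IsPreorder isPreorder public
    using () renaming (refl to ≤-refl; reflexive to ≤-reflexive; trans to ≤-trans)

  preorder : Preorder c ℓ₁ ℓ₂
  preorder = record { isPreorder = isPreorder }

  commutativeSemigroup : CommutativeSemigroup c ℓ₁
  commutativeSemigroup = record { isCommutativeSemigroup = isCommutativeSemigroup }

≼-trans : ∀ {A B C} → A ≼ B → B ≼ C → A ≼ C
≼-trans p here   = p
≼-trans p (⊗l q) = ⊗l (≼-trans p q)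
≼-trans p (⊗r q) = ⊗r (≼-trans p q)
≼-trans p (⇒l q) = ⇒l (≼-trans p q)
≼-trans p (⇒r q) = ⇒r (≼-trans p q)

Proper-≼ : ∀ {A B} → A ≼ B → Proper B → Proper A
Proper-≼ A≼B properB X Y X⇒Y≼A = properB X Y (≼-trans X⇒Y≼A A≼B)

module Soundness {c ℓ₁ ℓ₂} (M : ResiduatedCommutativeMonoid c ℓ₁ ℓ₂)
                 (ρ : ℕ → ResiduatedCommutativeMonoid.Carrier M) where

  open ResiduatedCommutativeMonoid M
  open CommutativeSemigroupProperties commutativeSemigroup using (x∙yz≈y∙xz)
  open PreorderReasoning preorder

  ⟦_⟧ : Formula → Carrier
  ⟦ var n ⟧ = ρ n
  ⟦ I ⟧     = ε
  ⟦ A ⊗ B ⟧ = ⟦ A ⟧ ∙ ⟦ B ⟧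
  ⟦ A ⇒ B ⟧ = ⟦ A ⟧ ⇨ ⟦ B ⟧

  ⟦_⟧* : List Formula → Carrier
  ⟦ [] ⟧*    = ε
  ⟦ A ∷ Γ ⟧* = ⟦ A ⟧ ∙ ⟦ Γ ⟧*

  ⟦++⟧ : ∀ Γ Δ → ⟦ Γ ++ Δ ⟧* ≈ ⟦ Γ ⟧* ∙ ⟦ Δ ⟧*
  ⟦++⟧ []      Δ = sym (identityˡ ⟦ Δ ⟧*)
  ⟦++⟧ (A ∷ Γ) Δ = trans (∙-congˡ (⟦++⟧ Γ Δ)) (sym (assoc ⟦ A ⟧ ⟦ Γ ⟧* ⟦ Δ ⟧*))

  ⟦++⟧-mono : ∀ Γ {Δ x y} → ⟦ Γ ⟧* ≤ x → ⟦ Δ ⟧* ≤ y → ⟦ Γ ++ Δ ⟧* ≤ x ∙ y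
  ⟦++⟧-mono Γ {Δ} p q = ≤-trans (≤-reflexive (⟦++⟧ Γ Δ)) (∙-mono p q)

  ⟦++⟧-monoʳ : ∀ Γ {Δ Δ′} → ⟦ Δ ⟧* ≤ ⟦ Δ′ ⟧* → ⟦ Γ ++ Δ ⟧* ≤ ⟦ Γ ++ Δ′ ⟧*
  ⟦++⟧-monoʳ []      p = p
  ⟦++⟧-monoʳ (A ∷ Γ) p = ∙-mono ≤-refl (⟦++⟧-monoʳ Γ p)

  sound : ∀ {Γ A} → Γ ⊢ A → ⟦ Γ ⟧* ≤ ⟦ A ⟧
  sound (ax {A})     = ≤-reflexive (identityʳ ⟦ A ⟧)
  sound axI          = ≤-refl
  sound (weak {Γ} d) = ≤-trans (≤-reflexive (identityˡ ⟦ Γ ⟧*)) (sound d)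
  sound (interch {Γ} {Δ} {A} {B} d) =
    ≤-trans (⟦++⟧-monoʳ Γ (≤-reflexive (x∙yz≈y∙xz ⟦ B ⟧ ⟦ A ⟧ ⟦ Δ ⟧*))) (sound d)
  sound (cut {Γ} {Δ} d₁ d₂) =
    ≤-trans (⟦++⟧-monoʳ Δ (⟦++⟧-mono Γ (sound d₁) ≤-refl)) (sound d₂)
  sound (⊗L {Γ} {Δ} {A} {B} d) =
    ≤-trans (⟦++⟧-monoʳ Γ (≤-reflexive (assoc ⟦ A ⟧ ⟦ B ⟧ ⟦ Δ ⟧*))) (sound d)
  sound (⊗R {Γ} d₁ d₂) = ⟦++⟧-mono Γ (sound d₁) (sound d₂)
  sound (⇒L {Γ} {Δ} {A} {B} {C} d₁ d₂) = begin
    ⟦ Γ ++ (A ⇒ B) ∷ Δ ⟧*              ≲⟨ ⟦++⟧-mono Γ (sound d₁) ≤-refl ⟩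
    ⟦ A ⟧ ∙ (⟦ A ⟧ ⇨ ⟦ B ⟧) ∙ ⟦ Δ ⟧*   ≈⟨ assoc ⟦ A ⟧ _ ⟦ Δ ⟧* ⟨
    (⟦ A ⟧ ∙ (⟦ A ⟧ ⇨ ⟦ B ⟧)) ∙ ⟦ Δ ⟧* ≲⟨ ∙-mono (⇨-eval ⟦ A ⟧ ⟦ B ⟧) ≤-refl ⟩
    ⟦ B ∷ Δ ⟧*                         ≲⟨ sound d₂ ⟩
    ⟦ C ⟧                              ∎
  sound (⇒R d) = ⇨-curry (sound d)

-- The three-element Sugihara monoid, -1 < 0 < 1 written bot < one < top.
data S₃ : Set where
  bot one top : S₃

infix 4 _≤₃_
data _≤₃_ : S₃ → S₃ → Set where
  bot≤    : ∀ {x} → bot ≤₃ x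
  one≤one : one ≤₃ one
  ≤top    : ∀ {x} → x ≤₃ top

infixr 6 _∙₃_
_∙₃_ : S₃ → S₃ → S₃
bot ∙₃ _   = bot
one ∙₃ y   = y
top ∙₃ bot = bot
top ∙₃ one = top
top ∙₃ top = top

infixr 5 _⇨₃_
_⇨₃_ : S₃ → S₃ → S₃
bot ⇨₃ _   = top
one ⇨₃ y   = y
top ⇨₃ top = top
top ⇨₃ _   = bot

≤₃-refl : ∀ {x} → x ≤₃ x
≤₃-refl {bot} = bot≤
≤₃-refl {one} = one≤one
≤₃-refl {top} = ≤top

≤₃-trans : ∀ {x y z} → x ≤₃ y → y ≤₃ z → x ≤₃ z
≤₃-trans bot≤    _    = bot≤
≤₃-trans one≤one q    = q
≤₃-trans ≤top    ≤top = ≤top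

top≰one : ¬ top ≤₃ one
top≰one ()

∙₃-assoc : ∀ x y z → (x ∙₃ y) ∙₃ z ≡ x ∙₃ y ∙₃ z
∙₃-assoc bot _   _   = refl
∙₃-assoc one _   _   = refl
∙₃-assoc top bot _   = refl
∙₃-assoc top one _   = refl
∙₃-assoc top top bot = refl
∙₃-assoc top top one = refl
∙₃-assoc top top top = refl

∙₃-comm : ∀ x y → x ∙₃ y ≡ y ∙₃ x
∙₃-comm bot bot = refl
∙₃-comm bot one = refl
∙₃-comm bot top = refl
∙₃-comm one bot = refl
∙₃-comm one one = refl
∙₃-comm one top = refl
∙₃-comm top bot = refl
∙₃-comm top one = refl
∙₃-comm top top = refl

∙₃-mono : _∙₃_ Preserves₂ _≤₃_ ⟶ _≤₃_ ⟶ _≤₃_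
∙₃-mono bot≤    _ = bot≤
∙₃-mono one≤one q = q
∙₃-mono {bot}             ≤top _       = bot≤
∙₃-mono {one} {u = bot}   ≤top _       = bot≤
∙₃-mono {one} {u = one}   ≤top one≤one = ≤top
∙₃-mono {one} {u = one}   ≤top ≤top    = ≤top
∙₃-mono {one} {u = top}   ≤top ≤top    = ≤top
∙₃-mono {top} {u = bot}   ≤top _       = bot≤
∙₃-mono {top} {u = one}   ≤top one≤one = ≤top
∙₃-mono {top} {u = one}   ≤top ≤top    = ≤top
∙₃-mono {top} {u = top}   ≤top ≤top    = ≤top

⇨₃-curry : ∀ {x y z} → x ∙₃ y ≤₃ z → y ≤₃ x ⇨₃ z
⇨₃-curry {bot}           _    = ≤top
⇨₃-curry {one}           p    = p
⇨₃-curry {top} {bot}     _    = bot≤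
⇨₃-curry {top} {one}     ≤top = ≤top
⇨₃-curry {top} {top}     ≤top = ≤top

⇨₃-eval : ∀ x y → x ∙₃ (x ⇨₃ y) ≤₃ y
⇨₃-eval bot _   = bot≤
⇨₃-eval one _   = ≤₃-refl
⇨₃-eval top bot = bot≤
⇨₃-eval top one = bot≤
⇨₃-eval top top = ≤top

sugihara₃ : ResiduatedCommutativeMonoid 0ℓ 0ℓ 0ℓ
sugihara₃ = record
  { Carrier             = S₃
  ; _≈_                 = _≡_
  ; _≤_                 = _≤₃_
  ; _∙_                 = _∙₃_
  ; ε                   = one
  ; _⇨_                 = _⇨₃_
  ; isCommutativeMonoid = isCommutativeMonoidˡ record
    { isSemigroup = record { isMagma = isMagma _∙₃_ ; assoc = ∙₃-assoc }
    ; identityˡ   = λ _ → refl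
    ; comm        = ∙₃-comm
    }
  ; isPreorder          = record
    { isEquivalence = isEquivalence
    ; reflexive     = λ { refl → ≤₃-refl }
    ; trans         = ≤₃-trans
    }
  ; ∙-mono              = ∙₃-mono
  ; ⇨-curry             = ⇨₃-curry
  ; ⇨-eval              = ⇨₃-eval
  }

open Soundness sugihara₃ (λ _ → top)

⟦constant⟧≡one : ∀ {A} → Constant A → ⟦ A ⟧ ≡ one
⟦constant⟧≡one cI       = refl
⟦constant⟧≡one (c⊗ p q) = cong₂ _∙₃_ (⟦constant⟧≡one p) (⟦constant⟧≡one q)
⟦constant⟧≡one (c⇒ p q) = cong₂ _⇨₃_ (⟦constant⟧≡one p) (⟦constant⟧≡one q)

⟦constantSeq⟧≡one : ∀ {Γ} → ConstantSeq Γ → ⟦ Γ ⟧* ≡ one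
⟦constantSeq⟧≡one []       = refl
⟦constantSeq⟧≡one (c ∷ cs) = cong₂ _∙₃_ (⟦constant⟧≡one c) (⟦constantSeq⟧≡one cs)

⟦⟧≡top⇒¬constant : ∀ {A} → ⟦ A ⟧ ≡ top → ¬ Constant A
⟦⟧≡top⇒¬constant ⟦A⟧≡top c with ≡.trans (≡.sym ⟦A⟧≡top) (⟦constant⟧≡one c)
... | ()

proper⇒constant⊎top : ∀ {A} → Proper A → Constant A ⊎ ⟦ A ⟧ ≡ top
proper⇒constant⊎top {var _} _ = inj₂ refl
proper⇒constant⊎top {I}     _ = inj₁ cI
proper⇒constant⊎top {A ⊗ B} p
  with proper⇒constant⊎top (Proper-≼ (⊗l here) p) | proper⇒constant⊎top (Proper-≼ (⊗r here) p)
... | inj₁ cA | inj₁ cB = inj₁ (c⊗ cA cB)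
... | inj₁ cA | inj₂ tB = inj₂ (cong₂ _∙₃_ (⟦constant⟧≡one cA) tB)
... | inj₂ tA | inj₁ cB = inj₂ (cong₂ _∙₃_ tA (⟦constant⟧≡one cB))
... | inj₂ tA | inj₂ tB = inj₂ (cong₂ _∙₃_ tA tB)
proper⇒constant⊎top {A ⇒ B} p
  with proper⇒constant⊎top (Proper-≼ (⇒l here) p) | proper⇒constant⊎top (Proper-≼ (⇒r here) p)
... | inj₁ cA | inj₁ cB = inj₁ (c⇒ cA cB)
... | inj₁ cA | inj₂ tB = inj₂ (cong₂ _⇨₃_ (⟦constant⟧≡one cA) tB)
... | inj₂ tA | inj₁ cB = ⊥-elim (p A B here (cB , ⟦⟧≡top⇒¬constant tA))
... | inj₂ tA | inj₂ tB = inj₂ (cong₂ _⇨₃_ tA tB)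

properSeq⇒constantSeq⊎top : ∀ {Γ} → ProperSeq Γ → ConstantSeq Γ ⊎ ⟦ Γ ⟧* ≡ top
properSeq⇒constantSeq⊎top []       = inj₁ []
properSeq⇒constantSeq⊎top (p ∷ ps) with proper⇒constant⊎top p | properSeq⇒constantSeq⊎top ps
... | inj₁ cA | inj₁ cΓ = inj₁ (cA ∷ cΓ)
... | inj₁ cA | inj₂ tΓ = inj₂ (cong₂ _∙₃_ (⟦constant⟧≡one cA) tΓ)
... | inj₂ tA | inj₁ cΓ = inj₂ (cong₂ _∙₃_ tA (⟦constantSeq⟧≡one cΓ))
... | inj₂ tA | inj₂ tΓ = inj₂ (cong₂ _∙₃_ tA tΓ)

lemma2p7 : (Γ : List Formula) (A : Formula) → Γ ⊢ A → ProperSeq Γ → Constant A →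
    ConstantSeq Γ
lemma2p7 Γ A d properΓ constantA with properSeq⇒constantSeq⊎top properΓ
... | inj₁ constantΓ = constantΓ
... | inj₂ ⟦Γ⟧≡top   =
  ⊥-elim (top≰one (subst₂ _≤₃_ ⟦Γ⟧≡top (⟦constant⟧≡one constantA) (sound d)))
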